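{- Let $N\ge1$, $A,B\subseteq\{0,1,\dots,2^N-1\}$, and let $\alpha=\overline{(\sum^\circ_{i\in A}y_i^{(N)},N)}$ and $\beta=\overline{(\sum^\circ_{j\in B}y_j^{(N)},N)}$ in $S_c[X]$. Then $\alpha\vdash\beta$ if and only if $A\subseteq B$.
   Context: A semiring is a set with operations $\circ$ (commutative monoid, identity $\theta$) and $\cdot$ (monoid, identity $1$), $\cdot$ distributing over $\circ$ on both sides, $\theta$ absorbing for $\cdot$, $1\ne\theta$. Let $X=\{x_1,x_2,\dots\}$ be countable. For $N\ge1$ let $S_c[X_N]$ be the quotient of the free commutative semiring on $\{x_1,\dots,x_N,x_1^c,\dots,x_N^c\}$ by the congruence generated by $(x_i\cdot x_i^c,\theta)$, $(x_i\circ x_i^c,1)$, $(x_i\circ x_i,x_i)$, $(x_i^c\circ x_i^c,x_i^c)$, $1\le i\le N$. For $k=\sum_{l=1}^N j_l2^{l-1}$, $j_l\in\{0,1\}$, put $y_k^{(N)}=x_1^{j_1}\cdots x_N^{j_N}$ with $x_l^1=x_l$, $x_l^0=x_l^c$; every element of $S_c[X_N]$ is uniquely $\sum^\circ_{k\in D}y_k^{(N)}$ with $D\subseteq\{0,\dots,2^N-1\}$ (empty sum $=\theta$). For $N\le M$ let $f_{NM}:S_c[X_N]\to S_c[X_M]$ be the homomorphism induced by $x_i\mapsto x_i,x_i^c\mapsto x_i^c$. $S_c[X]$ (the free I-C semiring on $X$) is the direct limit: classes $\overline{(a,i)}$, $a\in S_c[X_i]$, with $(a,i)\sim(b,j)$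 iff $f_{ik}(a)=f_{jk}(b)$ for some $k\ge i,j$, operations computed at a common level $k$. For $\Gamma\subseteq S_c[X]$ let $\equiv_\Gamma$ be the congruence on $S_c[X]$ generated by $\{(\alpha,1):\alpha\in\Gamma\}$; $\Gamma\vdash\beta$ means $\beta\equiv_\Gamma1$, and $\alpha\vdash\beta$ means $\{\alpha\}\vdash\beta$. -}

module Defs where

open import Data.Nat using (ℕ; zero; suc; _≤_; s≤s; _≡ᵇ_; _⊔_)
open import Data.Nat.DivMod using (_/_; _%_)
open import Data.Nat.Properties using (m≤m⊔n; m≤n⊔m)
open import Data.Bool using (Bool; true; false)
open import Data.Fin using (Fin; zero; suc; fromℕ; inject₁; inject≤; toℕ)
open import Data.Fin.Subset using (Subset)
open import Data.Vec using ([]; _∷_)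
open import Data.Product using (Σ; ∃; _,_; proj₁)

-- Terms of the free commutative semiring on {x_1..x_n, x_1^c..x_n^c}.
-- Fin index i (0-based) stands for x_{i+1}.
-- _⊕_ is the operation ∘, _⊙_ is the operation ·, θ and 𝟏 the identities.

infixl 6 _⊕_
infixl 7 _⊙_

data Term (n : ℕ) : Set where
  x  : Fin n → Term n
  xc : Fin n → Term n
  θ  : Term n
  𝟏  : Term n
  _⊕_ : Term n → Term n → Term n
  _⊙_ : Term n → Term n → Term n

-- Equality in S_c[X_n]: the congruence on terms generated by the
-- commutative-semiring axioms (giving the free commutative semiring)
-- together with the four defining relations of S_c[X_n].
infix 4 _≈_
data _≈_ {n : ℕ} : Term n → Term n → Set where
  ≈-refl  : ∀ {a} → a ≈ a
  ≈-sym   : ∀ {a b} → a ≈ b → b ≈ a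
  ≈-trans : ∀ {a b c} → a ≈ b → b ≈ c → a ≈ c
  ⊕-cong  : ∀ {a a′ b b′} → a ≈ a′ → b ≈ b′ → a ⊕ b ≈ a′ ⊕ b′
  ⊙-cong  : ∀ {a a′ b b′} → a ≈ a′ → b ≈ b′ → a ⊙ b ≈ a′ ⊙ b′
  ⊕-assoc : ∀ a b c → (a ⊕ b) ⊕ c ≈ a ⊕ (b ⊕ c)
  ⊕-comm  : ∀ a b → a ⊕ b ≈ b ⊕ a
  ⊕-identityˡ : ∀ a → θ ⊕ a ≈ a
  ⊙-assoc : ∀ a b c → (a ⊙ b) ⊙ c ≈ a ⊙ (b ⊙ c)
  ⊙-comm  : ∀ a b → a ⊙ b ≈ b ⊙ a
  ⊙-identityˡ : ∀ a → 𝟏 ⊙ a ≈ a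
  distribˡ : ∀ a b c → a ⊙ (b ⊕ c) ≈ (a ⊙ b) ⊕ (a ⊙ c)
  distribʳ : ∀ a b c → (b ⊕ c) ⊙ a ≈ (b ⊙ a) ⊕ (c ⊙ a)
  zeroˡ   : ∀ a → θ ⊙ a ≈ θ
  compl   : ∀ i → x i ⊙ xc i ≈ θ
  cover   : ∀ i → x i ⊕ xc i ≈ 𝟏
  idem-x  : ∀ i → x i ⊕ x i ≈ x i
  idem-xc : ∀ i → xc i ⊕ xc i ≈ xc i

rename : ∀ {m n} → (Fin m → Fin n) → Term m → Term n
rename ρ (x i) = x (ρ i)
rename ρ (xc i) = xc (ρ i)
rename ρ θ = θ
rename ρ 𝟏 = 𝟏
rename ρ (a ⊕ b) = rename ρ a ⊕ rename ρ b
rename ρ (a ⊙ b) = rename ρ a ⊙ rename ρ b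

f : ∀ {m n} → m ≤ n → Term m → Term n
f m≤n = rename (λ i → inject≤ i m≤n)

-- bit k l = the l-th binary digit of k (l = 0 least significant)
bit : ℕ → ℕ → Bool
bit k zero = (k % 2) ≡ᵇ 1
bit k (suc l) = bit (k / 2) l

-- x_i^1 = x_i, x_i^0 = x_i^c
lit : ∀ {n} → Fin n → Bool → Term n
lit i true = x i
lit i false = xc i

-- y N k = x_1^{j_1} ⋯ x_N^{j_N}, k = Σ j_l 2^{l-1}
-- (written as 𝟏 · x_1^{j_1} ⋯ x_N^{j_N}, equal in S_c[X_N])
y : (N : ℕ) → ℕ → Term N
y zero k = 𝟏
y (suc N) k = rename inject₁ (y N k) ⊙ lit (fromℕ N) (bit k N)

⨁ : ∀ {m n} → Subset m → (Fin m → Term n) → Term n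
⨁ [] g = θ
⨁ (true ∷ D) g = g zero ⊕ ⨁ D (λ k → g (suc k))
⨁ (false ∷ D) g = ⨁ D (λ k → g (suc k))

sumY : (N : ℕ) → Subset (2 Data.Nat.^ N) → Term N
sumY N D = ⨁ D (λ k → y N (toℕ k))

-- The direct limit S_c[X].  A pair (n , a) denotes (a , suc n) with
-- a ∈ S_c[X_{suc n}] (levels N ≥ 1, as in the paper).

SX : Set
SX = Σ ℕ (λ n → Term (suc n))

infix 4 _∼_
_∼_ : SX → SX → Set
(i , a) ∼ (j , b) = Σ ℕ λ k → Σ (i ≤ k) λ p → Σ (j ≤ k) λ q →
  f (s≤s p) a ≈ f (s≤s q) b

_⊕ˢ_ : SX → SX → SX
(i , a) ⊕ˢ (j , b) = (i ⊔ j) , (f (s≤s (m≤m⊔n i j)) a ⊕ f (s≤s (m≤n⊔m i j)) b)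

_⊙ˢ_ : SX → SX → SX
(i , a) ⊙ˢ (j , b) = (i ⊔ j) , (f (s≤s (m≤m⊔n i j)) a ⊙ f (s≤s (m≤n⊔m i j)) b)

oneˢ : SX
oneˢ = 0 , 𝟏

data _≡[_]_ (Γ : SX → Set) : SX → SX → Set where
  base  : ∀ {a b} → a ∼ b → Γ ≡[ a ] b
  gen   : ∀ {α} → Γ α → Γ ≡[ α ] oneˢ
  symΓ  : ∀ {a b} → Γ ≡[ a ] b → Γ ≡[ b ] a
  transΓ : ∀ {a b c} → Γ ≡[ a ] b → Γ ≡[ b ] c → Γ ≡[ a ] c
  ⊕ˢ-cong : ∀ {a a′ b b′} → Γ ≡[ a ] a′ → Γ ≡[ b ] b′ → Γ ≡[ a ⊕ˢ b ] (a′ ⊕ˢ b′)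
  ⊙ˢ-cong : ∀ {a a′ b b′} → Γ ≡[ a ] a′ → Γ ≡[ b ] b′ → Γ ≡[ a ⊙ˢ b ] (a′ ⊙ˢ b′)

_⊢_ : (SX → Set) → SX → Set
Γ ⊢ β = Γ ≡[ β ] oneˢ

_⊢₁_ : SX → SX → Set
α ⊢₁ β = (λ γ → γ ∼ α) ⊢ β

{-# OPTIONS --safe #-}

-- Evaluating the generators in Bool respects every defining relation of S_c[X], so β ≡_α 1
-- forces β to be true under every valuation that makes α true.  Under the valuation given by
-- the binary digits of k, y_j is true iff j = k, so ∑°_{i∈A} y_i is true iff k ∈ A; hence
-- α ⊢ β gives A ⊆ B.  Conversely, for N ≥ 1 the operation ∘ is idempotent and 1 is the top
-- element, so A ⊆ B gives β = α ∘ β ≡_α 1 ∘ β = 1.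

module Submission where

open import Defs
open import Algebra.Bundles using (CommutativeMonoid)
open import Algebra.Structures using (IsCommutativeMonoid)
import Algebra.Properties.CommutativeSemigroup as CommutativeSemigroupProperties
open import Data.Bool using (Bool; true; false; _∨_; _∧_; not)
open import Data.Bool.Properties
  using (∨-assoc; ∨-comm; ∨-idem; ∨-zeroʳ; ∨-inverseʳ; ∧-assoc; ∧-comm; ∧-inverseʳ;
         ∧-distribˡ-∨; ∧-distribʳ-∨; ∧-conicalˡ; ∧-conicalʳ; not-injective)
open import Data.Fin using (Fin; zero; suc; toℕ; fromℕ; inject₁)
open import Data.Fin.Properties using (toℕ-injective; toℕ-inject≤; toℕ-inject₁; toℕ-fromℕ; toℕ<n)
open import Data.Fin.Relation.Unary.Top using (view; ‵fromℕ; ‵inject₁)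
open import Data.Fin.Subset using (Subset; _⊆_; _∈_)
open import Data.Fin.Subset.Properties using (drop-∷-⊆)
open import Data.Nat using (ℕ; suc; _^_; _≤_; _<_; _≡ᵇ_; _+_; _*_; z≤n; s≤s; _⊔_)
open import Data.Nat.DivMod using (_/_; _%_; m≡m%n+[m/n]*n; m%n<n; m<n*o⇒m/o<n)
open import Data.Nat.Properties using (≤-refl; m≤m⊔n; m≤n⊔m; *-comm)
open import Data.Product using (_,_; Σ-syntax; _×_)
open import Data.Vec using ([]; _∷_; here; there)
open import Function using (_∘_)
open import Function.Bundles using (_⇔_; mk⇔; Equivalence)
open import Relation.Binary.PropositionalEquality
  using (_≡_; refl; sym; trans; cong; cong₂; subst; subst₂; module ≡-Reasoning)

eval : ∀ {n} → (Fin n → Bool) → Term n → Bool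
eval w (x i)   = w i
eval w (xc i)  = not (w i)
eval w θ       = false
eval w 𝟏       = true
eval w (a ⊕ b) = eval w a ∨ eval w b
eval w (a ⊙ b) = eval w a ∧ eval w b

eval-cong : ∀ {n} {a b : Term n} → a ≈ b → ∀ w → eval w a ≡ eval w b
eval-cong ≈-refl              w = refl
eval-cong (≈-sym p)           w = sym (eval-cong p w)
eval-cong (≈-trans p q)       w = trans (eval-cong p w) (eval-cong q w)
eval-cong (⊕-cong p q)        w = cong₂ _∨_ (eval-cong p w) (eval-cong q w)
eval-cong (⊙-cong p q)        w = cong₂ _∧_ (eval-cong p w) (eval-cong q w)
eval-cong (⊕-assoc a b c)     w = ∨-assoc (eval w a) (eval w b) (eval w c)
eval-cong (⊕-comm a b)        w = ∨-comm (eval w a) (eval w b)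
eval-cong (⊕-identityˡ a)     w = refl
eval-cong (⊙-assoc a b c)     w = ∧-assoc (eval w a) (eval w b) (eval w c)
eval-cong (⊙-comm a b)        w = ∧-comm (eval w a) (eval w b)
eval-cong (⊙-identityˡ a)     w = refl
eval-cong (distribˡ a b c)    w = ∧-distribˡ-∨ (eval w a) (eval w b) (eval w c)
eval-cong (distribʳ a b c)    w = ∧-distribʳ-∨ (eval w a) (eval w b) (eval w c)
eval-cong (zeroˡ a)           w = refl
eval-cong (compl i)           w = ∧-inverseʳ (w i)
eval-cong (cover i)           w = ∨-inverseʳ (w i)
eval-cong (idem-x i)          w = ∨-idem (w i)
eval-cong (idem-xc i)         w = ∨-idem (not (w i))

eval-rename : ∀ {m n} (ρ : Fin m → Fin n) (w : Fin n → Bool) t →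
  eval w (rename ρ t) ≡ eval (w ∘ ρ) t
eval-rename ρ w (x i)   = refl
eval-rename ρ w (xc i)  = refl
eval-rename ρ w θ       = refl
eval-rename ρ w 𝟏       = refl
eval-rename ρ w (a ⊕ b) = cong₂ _∨_ (eval-rename ρ w a) (eval-rename ρ w b)
eval-rename ρ w (a ⊙ b) = cong₂ _∧_ (eval-rename ρ w a) (eval-rename ρ w b)

eval-ext : ∀ {n} {w w′ : Fin n → Bool} → (∀ i → w i ≡ w′ i) → ∀ t → eval w t ≡ eval w′ t
eval-ext h (x i)   = h i
eval-ext h (xc i)  = cong not (h i)
eval-ext h θ       = refl
eval-ext h 𝟏       = refl
eval-ext h (a ⊕ b) = cong₂ _∨_ (eval-ext h a) (eval-ext h b)
eval-ext h (a ⊙ b) = cong₂ _∧_ (eval-ext h a) (eval-ext h b)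

eval-f : ∀ {m n} (p : m ≤ n) (v : ℕ → Bool) t → eval (v ∘ toℕ) (f p t) ≡ eval (v ∘ toℕ) t
eval-f p v t = trans (eval-rename _ _ t) (eval-ext (λ i → cong v (toℕ-inject≤ i p)) t)

-- One valuation x_{l+1} ↦ v l of all generators serves every level of the direct limit.
⟦_⟧ : SX → (ℕ → Bool) → Bool
⟦ n , t ⟧ v = eval (v ∘ toℕ) t

⟦⟧-∼ : ∀ {a b} → a ∼ b → ∀ v → ⟦ a ⟧ v ≡ ⟦ b ⟧ v
⟦⟧-∼ {_ , a} {_ , b} (_ , p , q , e) v =
  trans (sym (eval-f (s≤s p) v a)) (trans (eval-cong e _) (eval-f (s≤s q) v b))

⟦⟧-⊕ˢ : ∀ a b v → ⟦ a ⊕ˢ b ⟧ v ≡ ⟦ a ⟧ v ∨ ⟦ b ⟧ v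
⟦⟧-⊕ˢ (i , a) (j , b) v =
  cong₂ _∨_ (eval-f (s≤s (m≤m⊔n i j)) v a) (eval-f (s≤s (m≤n⊔m i j)) v b)

⟦⟧-⊙ˢ : ∀ a b v → ⟦ a ⊙ˢ b ⟧ v ≡ ⟦ a ⟧ v ∧ ⟦ b ⟧ v
⟦⟧-⊙ˢ (i , a) (j , b) v =
  cong₂ _∧_ (eval-f (s≤s (m≤m⊔n i j)) v a) (eval-f (s≤s (m≤n⊔m i j)) v b)

_⊨_ : (ℕ → Bool) → (SX → Set) → Set
v ⊨ Γ = ∀ {γ} → Γ γ → ⟦ γ ⟧ v ≡ true

⟦⟧-≡[] : ∀ {Γ a b} v → v ⊨ Γ → Γ ≡[ a ] b → ⟦ a ⟧ v ≡ ⟦ b ⟧ v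
⟦⟧-≡[] v v⊨Γ (base e)     = ⟦⟧-∼ e v
⟦⟧-≡[] v v⊨Γ (gen γ)      = v⊨Γ γ
⟦⟧-≡[] v v⊨Γ (symΓ d)     = sym (⟦⟧-≡[] v v⊨Γ d)
⟦⟧-≡[] v v⊨Γ (transΓ d e) = trans (⟦⟧-≡[] v v⊨Γ d) (⟦⟧-≡[] v v⊨Γ e)
⟦⟧-≡[] v v⊨Γ (⊕ˢ-cong {a} {a′} {b} {b′} d e) =
  trans (⟦⟧-⊕ˢ a b v) (trans (cong₂ _∨_ (⟦⟧-≡[] v v⊨Γ d) (⟦⟧-≡[] v v⊨Γ e)) (sym (⟦⟧-⊕ˢ a′ b′ v)))
⟦⟧-≡[] v v⊨Γ (⊙ˢ-cong {a} {a′} {b} {b′} d e) =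
  trans (⟦⟧-⊙ˢ a b v) (trans (cong₂ _∧_ (⟦⟧-≡[] v v⊨Γ d) (⟦⟧-≡[] v v⊨Γ e)) (sym (⟦⟧-⊙ˢ a′ b′ v)))

⊢₁-sound : ∀ {α β} v → ⟦ α ⟧ v ≡ true → α ⊢₁ β → ⟦ β ⟧ v ≡ true
⊢₁-sound v α-true = ⟦⟧-≡[] v (λ γ∼α → trans (⟦⟧-∼ γ∼α v) α-true)

parity-injective : ∀ {a b} → a < 2 → b < 2 → (a ≡ᵇ 1) ≡ (b ≡ᵇ 1) → a ≡ b
parity-injective {0} {0} _ _ _ = refl
parity-injective {1} {1} _ _ _ = refl
parity-injective {0} {1} _ _ ()
parity-injective {1} {0} _ _ ()
parity-injective {suc (suc _)} (s≤s (s≤s ())) _ _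
parity-injective {_} {suc (suc _)} _ (s≤s (s≤s ())) _

bit-injective : ∀ N {a b} → a < 2 ^ N → b < 2 ^ N →
  (∀ (l : Fin N) → bit a (toℕ l) ≡ bit b (toℕ l)) → a ≡ b
bit-injective 0 {0} {0} _ _ _ = refl
bit-injective 0 {suc _} (s≤s ()) _ _
bit-injective 0 {_} {suc _} _ (s≤s ()) _
bit-injective (suc N) {a} {b} a< b< same-bits = begin
  a                 ≡⟨ m≡m%n+[m/n]*n a 2 ⟩
  a % 2 + a / 2 * 2 ≡⟨ cong₂ (λ r q → r + q * 2) same-parity same-quotient ⟩
  b % 2 + b / 2 * 2 ≡⟨ sym (m≡m%n+[m/n]*n b 2) ⟩
  b                 ∎
  where
  open ≡-Reasoning
  same-parity : a % 2 ≡ b % 2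
  same-parity = parity-injective (m%n<n a 2) (m%n<n b 2) (same-bits zero)
  halve : ∀ {c} → c < 2 ^ suc N → c / 2 < 2 ^ N
  halve {c} c< = m<n*o⇒m/o<n (subst (c <_) (*-comm 2 (2 ^ N)) c<)
  same-quotient : a / 2 ≡ b / 2
  same-quotient = bit-injective N (halve a<) (halve b<) (same-bits ∘ suc)

eval-lit⁺ : ∀ {n} (w : Fin n → Bool) i b → w i ≡ b → eval w (lit i b) ≡ true
eval-lit⁺ w i true  wi≡b = wi≡b
eval-lit⁺ w i false wi≡b = cong not wi≡b

eval-lit⁻ : ∀ {n} (w : Fin n → Bool) i b → eval w (lit i b) ≡ true → w i ≡ b
eval-lit⁻ w i true  e = e
eval-lit⁻ w i false e = not-injective e

eval-y⁺ : ∀ N j (w : Fin N → Bool) → (∀ l → w l ≡ bit j (toℕ l)) → eval w (y N j) ≡ true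
eval-y⁺ 0       j w w≡bits = refl
eval-y⁺ (suc N) j w w≡bits = cong₂ _∧_ init-true last-true
  where
  init-true : eval w (rename inject₁ (y N j)) ≡ true
  init-true = trans (eval-rename inject₁ w (y N j))
    (eval-y⁺ N j (w ∘ inject₁) (λ l → trans (w≡bits (inject₁ l)) (cong (bit j) (toℕ-inject₁ l))))
  last-true : eval w (lit (fromℕ N) (bit j N)) ≡ true
  last-true = eval-lit⁺ w (fromℕ N) (bit j N) (trans (w≡bits (fromℕ N)) (cong (bit j) (toℕ-fromℕ N)))

eval-y⁻ : ∀ N j (w : Fin N → Bool) → eval w (y N j) ≡ true → ∀ l → w l ≡ bit j (toℕ l)
eval-y⁻ (suc N) j w e l with view l
... | ‵fromℕ =
  trans (eval-lit⁻ w (fromℕ N) (bit j N) (∧-conicalʳ _ _ e)) (sym (cong (bit j) (toℕ-fromℕ N)))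
... | ‵inject₁ l′ =
  trans (eval-y⁻ N j (w ∘ inject₁) (trans (sym (eval-rename inject₁ w (y N j))) (∧-conicalˡ _ _ e)) l′)
        (sym (cong (bit j) (toℕ-inject₁ l′)))

eval-⨁⁺ : ∀ {m n} (D : Subset m) (g : Fin m → Term n) w {k} → k ∈ D →
  eval w (g k) ≡ true → eval w (⨁ D g) ≡ true
eval-⨁⁺ (true ∷ D)  g w here      e = cong (_∨ eval w (⨁ D (g ∘ suc))) e
eval-⨁⁺ (true ∷ D)  g w (there k) e =
  trans (cong (eval w (g zero) ∨_) (eval-⨁⁺ D (g ∘ suc) w k e)) (∨-zeroʳ _)
eval-⨁⁺ (false ∷ D) g w (there k) e = eval-⨁⁺ D (g ∘ suc) w k e

eval-⨁⁻ : ∀ {m n} (D : Subset m) (g : Fin m → Term n) w →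
  eval w (⨁ D g) ≡ true → Σ[ k ∈ Fin m ] k ∈ D × eval w (g k) ≡ true
eval-⨁⁻ (true ∷ D) g w e with eval w (g zero) in g₀-true
... | true  = zero , here , g₀-true
... | false with eval-⨁⁻ D (g ∘ suc) w e
...   | k , k∈D , gk-true = suc k , there k∈D , gk-true
eval-⨁⁻ (false ∷ D) g w e with eval-⨁⁻ D (g ∘ suc) w e
... | k , k∈D , gk-true = suc k , there k∈D , gk-true

eval-sumY-bit : ∀ N (D : Subset (2 ^ N)) (k : Fin (2 ^ N)) →
  eval (bit (toℕ k) ∘ toℕ) (sumY N D) ≡ true ⇔ k ∈ D
eval-sumY-bit N D k = mk⇔ true⇒∈ (λ k∈D → eval-⨁⁺ D _ _ k∈D (eval-y⁺ N (toℕ k) _ (λ _ → refl)))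
  where
  true⇒∈ : eval (bit (toℕ k) ∘ toℕ) (sumY N D) ≡ true → k ∈ D
  true⇒∈ e with eval-⨁⁻ D _ _ e
  ... | j , j∈D , yj-true = subst (_∈ D) (sym k≡j) j∈D
    where
    k≡j = toℕ-injective (bit-injective N (toℕ<n k) (toℕ<n j) (eval-y⁻ N (toℕ j) _ yj-true))

⊢₁-sumY⇒⊆ : ∀ n (A B : Subset (2 ^ suc n)) →
  (n , sumY (suc n) A) ⊢₁ (n , sumY (suc n) B) → A ⊆ B
⊢₁-sumY⇒⊆ n A B α⊢β {k} k∈A =
  to (eval-sumY-bit (suc n) B k) (⊢₁-sound (bit (toℕ k)) (from (eval-sumY-bit (suc n) A k) k∈A) α⊢β)
  where open Equivalence

module _ {n : ℕ} where

  ⊕-identityʳ : (a : Term n) → a ⊕ θ ≈ a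
  ⊕-identityʳ a = ≈-trans (⊕-comm a θ) (⊕-identityˡ a)

  ⊙-identityʳ : (a : Term n) → a ⊙ 𝟏 ≈ a
  ⊙-identityʳ a = ≈-trans (⊙-comm a 𝟏) (⊙-identityˡ a)

  ⊕-isCommutativeMonoid : IsCommutativeMonoid (_≈_ {n}) _⊕_ θ
  ⊕-isCommutativeMonoid = record
    { isMonoid = record
      { isSemigroup = record
        { isMagma = record
          { isEquivalence = record { refl = ≈-refl ; sym = ≈-sym ; trans = ≈-trans }
          ; ∙-cong = ⊕-cong
          }
        ; assoc = ⊕-assoc
        }
      ; identity = ⊕-identityˡ , ⊕-identityʳ
      }
    ; comm = ⊕-comm
    }

  ⊕-commutativeMonoid : CommutativeMonoid _ _
  ⊕-commutativeMonoid = record { isCommutativeMonoid = ⊕-isCommutativeMonoid }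

  open CommutativeMonoid ⊕-commutativeMonoid using (setoid; commutativeSemigroup)
  open CommutativeSemigroupProperties commutativeSemigroup using (interchange; x∙yz≈y∙xz; xy∙z≈xz∙y)
  open import Relation.Binary.Reasoning.Setoid setoid

  ⊕-absorbs-⊙ : ∀ (a : Term n) {b} → 𝟏 ⊕ b ≈ 𝟏 → a ⊕ a ⊙ b ≈ a
  ⊕-absorbs-⊙ a {b} 𝟏⊕b≈𝟏 = begin
    a ⊕ a ⊙ b     ≈⟨ ⊕-cong (≈-sym (⊙-identityʳ a)) ≈-refl ⟩
    a ⊙ 𝟏 ⊕ a ⊙ b ≈⟨ ≈-sym (distribˡ a 𝟏 b) ⟩
    a ⊙ (𝟏 ⊕ b)   ≈⟨ ⊙-cong ≈-refl 𝟏⊕b≈𝟏 ⟩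
    a ⊙ 𝟏         ≈⟨ ⊙-identityʳ a ⟩
    a             ∎

  𝟏-⊕-x : ∀ i → 𝟏 ⊕ x i ≈ 𝟏
  𝟏-⊕-x i = begin
    𝟏 ⊕ x i            ≈⟨ ⊕-cong (≈-sym (cover i)) ≈-refl ⟩
    (x i ⊕ xc i) ⊕ x i ≈⟨ xy∙z≈xz∙y (x i) (xc i) (x i) ⟩
    (x i ⊕ x i) ⊕ xc i ≈⟨ ⊕-cong (idem-x i) ≈-refl ⟩
    x i ⊕ xc i         ≈⟨ cover i ⟩
    𝟏                  ∎

  𝟏-⊕-xc : ∀ i → 𝟏 ⊕ xc i ≈ 𝟏
  𝟏-⊕-xc i = begin
    𝟏 ⊕ xc i             ≈⟨ ⊕-cong (≈-sym (cover i)) ≈-refl ⟩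
    (x i ⊕ xc i) ⊕ xc i  ≈⟨ ⊕-assoc (x i) (xc i) (xc i) ⟩
    x i ⊕ (xc i ⊕ xc i)  ≈⟨ ⊕-cong ≈-refl (idem-xc i) ⟩
    x i ⊕ xc i           ≈⟨ cover i ⟩
    𝟏                    ∎

  -- Needs a generator: in S_c[X_0] ≅ ℕ one has 𝟏 ⊕ 𝟏 ≠ 𝟏.
  𝟏-⊕-𝟏 : Fin n → 𝟏 ⊕ 𝟏 ≈ 𝟏
  𝟏-⊕-𝟏 i = begin
    𝟏 ⊕ 𝟏                ≈⟨ ⊕-cong ≈-refl (≈-sym (cover i)) ⟩
    𝟏 ⊕ (x i ⊕ xc i)     ≈⟨ ≈-sym (⊕-assoc 𝟏 (x i) (xc i)) ⟩
    (𝟏 ⊕ x i) ⊕ xc i     ≈⟨ ⊕-cong (𝟏-⊕-x i) ≈-refl ⟩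
    𝟏 ⊕ xc i             ≈⟨ 𝟏-⊕-xc i ⟩
    𝟏                    ∎

  ⊕-idem : Fin n → ∀ (a : Term n) → a ⊕ a ≈ a
  ⊕-idem i a = ≈-trans (⊕-cong ≈-refl (≈-sym (⊙-identityʳ a))) (⊕-absorbs-⊙ a (𝟏-⊕-𝟏 i))

  ⊕-zeroˡ : Fin n → ∀ (a : Term n) → 𝟏 ⊕ a ≈ 𝟏
  ⊕-zeroˡ i (x j)   = 𝟏-⊕-x j
  ⊕-zeroˡ i (xc j)  = 𝟏-⊕-xc j
  ⊕-zeroˡ i θ       = ⊕-identityʳ 𝟏
  ⊕-zeroˡ i 𝟏       = 𝟏-⊕-𝟏 i
  ⊕-zeroˡ i (a ⊕ b) = begin
    𝟏 ⊕ (a ⊕ b)  ≈⟨ ≈-sym (⊕-assoc 𝟏 a b) ⟩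
    (𝟏 ⊕ a) ⊕ b  ≈⟨ ⊕-cong (⊕-zeroˡ i a) ≈-refl ⟩
    𝟏 ⊕ b        ≈⟨ ⊕-zeroˡ i b ⟩
    𝟏            ∎
  ⊕-zeroˡ i (a ⊙ b) = begin
    𝟏 ⊕ a ⊙ b        ≈⟨ ⊕-cong (≈-sym (⊕-zeroˡ i a)) ≈-refl ⟩
    (𝟏 ⊕ a) ⊕ a ⊙ b  ≈⟨ ⊕-assoc 𝟏 a (a ⊙ b) ⟩
    𝟏 ⊕ (a ⊕ a ⊙ b)  ≈⟨ ⊕-cong ≈-refl (⊕-absorbs-⊙ a (⊕-zeroˡ i b)) ⟩
    𝟏 ⊕ a            ≈⟨ ⊕-zeroˡ i a ⟩
    𝟏                ∎

  _≼_ : Term n → Term n → Set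
  a ≼ b = a ⊕ b ≈ b

  ⨁-mono : Fin n → ∀ {m} {A B : Subset m} (g : Fin m → Term n) → A ⊆ B → ⨁ A g ≼ ⨁ B g
  ⨁-mono i {A = []}        {[]}        g A⊆B = ⊕-identityˡ θ
  ⨁-mono i {A = true ∷ A}  {true ∷ B}  g A⊆B = begin
    (g zero ⊕ ⨁ A (g ∘ suc)) ⊕ (g zero ⊕ ⨁ B (g ∘ suc))
      ≈⟨ interchange (g zero) (⨁ A (g ∘ suc)) (g zero) (⨁ B (g ∘ suc)) ⟩
    (g zero ⊕ g zero) ⊕ (⨁ A (g ∘ suc) ⊕ ⨁ B (g ∘ suc))
      ≈⟨ ⊕-cong (⊕-idem i (g zero)) (⨁-mono i (g ∘ suc) (drop-∷-⊆ A⊆B)) ⟩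
    g zero ⊕ ⨁ B (g ∘ suc) ∎
  ⨁-mono i {A = false ∷ A} {true ∷ B}  g A⊆B = begin
    ⨁ A (g ∘ suc) ⊕ (g zero ⊕ ⨁ B (g ∘ suc))
      ≈⟨ x∙yz≈y∙xz (⨁ A (g ∘ suc)) (g zero) (⨁ B (g ∘ suc)) ⟩
    g zero ⊕ (⨁ A (g ∘ suc) ⊕ ⨁ B (g ∘ suc))
      ≈⟨ ⊕-cong ≈-refl (⨁-mono i (g ∘ suc) (drop-∷-⊆ A⊆B)) ⟩
    g zero ⊕ ⨁ B (g ∘ suc) ∎
  ⨁-mono i {A = false ∷ A} {false ∷ B} g A⊆B = ⨁-mono i (g ∘ suc) (drop-∷-⊆ A⊆B)
  ⨁-mono i {A = true ∷ A}  {false ∷ B} g A⊆B with A⊆B here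
  ... | ()

rename-ext : ∀ {m n} {ρ σ : Fin m → Fin n} → (∀ i → ρ i ≡ σ i) → ∀ t → rename ρ t ≡ rename σ t
rename-ext h (x i)   = cong x (h i)
rename-ext h (xc i)  = cong xc (h i)
rename-ext h θ       = refl
rename-ext h 𝟏       = refl
rename-ext h (a ⊕ b) = cong₂ _⊕_ (rename-ext h a) (rename-ext h b)
rename-ext h (a ⊙ b) = cong₂ _⊙_ (rename-ext h a) (rename-ext h b)

rename-id : ∀ {n} {ρ : Fin n → Fin n} → (∀ i → ρ i ≡ i) → ∀ t → rename ρ t ≡ t
rename-id h (x i)   = cong x (h i)
rename-id h (xc i)  = cong xc (h i)
rename-id h θ       = refl
rename-id h 𝟏       = refl
rename-id h (a ⊕ b) = cong₂ _⊕_ (rename-id h a) (rename-id h b)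
rename-id h (a ⊙ b) = cong₂ _⊙_ (rename-id h a) (rename-id h b)

rename-∘ : ∀ {k m n} (ρ : Fin m → Fin n) (σ : Fin k → Fin m) t →
  rename ρ (rename σ t) ≡ rename (ρ ∘ σ) t
rename-∘ ρ σ (x i)   = refl
rename-∘ ρ σ (xc i)  = refl
rename-∘ ρ σ θ       = refl
rename-∘ ρ σ 𝟏       = refl
rename-∘ ρ σ (a ⊕ b) = cong₂ _⊕_ (rename-∘ ρ σ a) (rename-∘ ρ σ b)
rename-∘ ρ σ (a ⊙ b) = cong₂ _⊙_ (rename-∘ ρ σ a) (rename-∘ ρ σ b)

f-id : ∀ {n} (p : n ≤ n) t → f p t ≡ t
f-id p = rename-id (λ i → toℕ-injective (toℕ-inject≤ i p))

f-∘ : ∀ {k l m} (p : l ≤ m) (q : k ≤ l) (r : k ≤ m) t → f p (f q t) ≡ f r t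
f-∘ p q r t = trans (rename-∘ _ _ t) (rename-ext (λ i → toℕ-injective
  (trans (toℕ-inject≤ _ p) (trans (toℕ-inject≤ i q) (sym (toℕ-inject≤ i r))))) t)

≈⇒∼ : ∀ {n} {a b : Term (suc n)} → a ≈ b → (n , a) ∼ (n , b)
≈⇒∼ {n} {a} {b} a≈b =
  n , ≤-refl , ≤-refl , subst₂ _≈_ (sym (f-id (s≤s ≤-refl) a)) (sym (f-id (s≤s ≤-refl) b)) a≈b

∼-refl : ∀ {a} → a ∼ a
∼-refl {n , a} = ≈⇒∼ ≈-refl

⊕ˢ-same-level : ∀ {n} (a b : Term (suc n)) → (n , a ⊕ b) ∼ ((n , a) ⊕ˢ (n , b))
⊕ˢ-same-level {n} a b = n ⊔ n , m≤m⊔n n n , ≤-refl ,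
  reflexive (sym (cong₂ _⊕_ (f-∘ (s≤s ≤-refl) n≤n⊔n n≤n⊔n a)
                            (f-∘ (s≤s ≤-refl) (s≤s (m≤n⊔m n n)) n≤n⊔n b)))
  where
  open CommutativeMonoid (⊕-commutativeMonoid {suc (n ⊔ n)}) using (reflexive)
  n≤n⊔n = s≤s (m≤m⊔n n n)

≼⇒⊢₁ : ∀ {n} {a b : Term (suc n)} → a ≼ b → (n , a) ⊢₁ (n , b)
≼⇒⊢₁ {n} {a} {b} a≼b =
  transΓ (base (≈⇒∼ (≈-sym a≼b)))
  (transΓ (base (⊕ˢ-same-level a b))
  (transΓ (⊕ˢ-cong (gen ∼-refl) (base ∼-refl))
          (base (n , ≤-refl , z≤n , ⊕-zeroˡ zero _))))

proposition4p9 : (n : ℕ) (A B : Subset (2 ^ suc n)) →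
    ((n , sumY (suc n) A) ⊢₁ (n , sumY (suc n) B)) ⇔ (A ⊆ B)
proposition4p9 n A B = mk⇔ (⊢₁-sumY⇒⊆ n A B) (λ A⊆B → ≼⇒⊢₁ (⨁-mono zero _ A⊆B))
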